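{- Let $k$ be a positive even integer. In the maximum-cardinality online bipartite matching problem under vertex arrivals with a hard budget of $k$ on the number of reassignments (defined in the context), the shortest-augmenting-path algorithm described in the context is $\left(1-\frac{2}{k+2}\right)$-competitive.
   Context: Problem. Let $G=(L\cup R,E)$ be a bipartite graph. An online algorithm initially knows only $R$ and the budget $k$. Over $|L|$ timesteps, the vertices of $L$ arrive one at a time; when a vertex arrives, all of its incident edges are revealed. The current graph consists of $R$, the arrived vertices of $L$, and the revealed edges. At the end of each timestep the algorithm must output a matching in the current graph, obtained from its previous matching (the matching before the first timestep is $\emptyset$) by at most $k$ (re)assignments, where the number of (re)assignments needed to go from matching $M_1$ to matching $M_2$ is the number of vertices incident to at least one edge of the symmetric difference $M_1\triangle M_2$. Moreover, once a vertex is matched, it must remain matched at all later timesteps. An algorithm is $\rho$-competitive if there is a constant $c\ge 0$ such that on every instance the final matching has cardinality at least $\rho\cdot\mathsf{OPT}-c$, where $\mathsf{OPT}$ is the maximum cardinality of a matching in $G$. Algorithm. An augmenting path with respect to a matching $M$ is a path whose two endpoints are distinct vertices not covered by $M$ and whose edges alternate between edges not in $M$ and edges in $M$. When vertex $u$ arrives, the algorithm finds a shortest augmenting path (with respect to the current matching, in the current graph) that contains $u$; if no such path exists or its length (number of edges) exceeds $k-1$, it does nothing; otherwise it replaces the current matching $M$ by $M\triangle P$ for that path $P$. -}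

module Defs where

open import Data.Nat using (ℕ; zero; suc; _+_; _*_; _∸_; _≤_; _<_)
open import Data.Fin using (Fin; toℕ)
open import Data.Fin.Properties using (_≟_)
open import Data.Bool using (Bool; true; false; _xor_; _∧_; _∨_; not; if_then_else_)
open import Data.List using (List; []; _∷_; _++_; [_]; length; map; allFin)
open import Data.Nat.ListAction using (sum)
open import Data.Bool.ListAction using (any)
open import Data.List.Membership.Propositional using (_∈_)
open import Data.List.Relation.Unary.Unique.Propositional using (Unique)
open import Data.List.Relation.Unary.Linked using (Linked)
open import Data.Sum using (_⊎_; inj₁; inj₂)
open import Data.Product using (_×_; _,_; ∃-syntax)
open import Data.Empty using (⊥)
open import Data.Unit using (⊤)
open import Relation.Nullary using (¬_)
open import Relation.Nullary.Decidable using (⌊_⌋)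
open import Relation.Binary.PropositionalEquality using (_≡_)

-- Bipartite graph G = (L ∪ R, E) with L = Fin n (left vertices, arriving in
-- the order 0, 1, …, n-1) and R = Fin r.
EdgeSet : ℕ → ℕ → Set
EdgeSet n r = Fin n → Fin r → Bool

emptyES : ∀ {n r} → EdgeSet n r
emptyES _ _ = false

size : ∀ {n r} → EdgeSet n r → ℕ
size {n} {r} M = sum (map (λ l → sum (map (λ x → if M l x then 1 else 0) (allFin r))) (allFin n))

IsMatchingIn : ∀ {n r} → (Fin n → Fin r → Bool) → ℕ → EdgeSet n r → Set
IsMatchingIn {n} {r} adj t M =
  (∀ l x → M l x ≡ true → (toℕ l < t) × (adj l x ≡ true)) ×
  (∀ l x x′ → M l x ≡ true → M l x′ ≡ true → x ≡ x′) ×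
  (∀ l l′ x → M l x ≡ true → M l′ x ≡ true → l ≡ l′)

IsMaxMatching : ∀ {n r} → (Fin n → Fin r → Bool) → EdgeSet n r → Set
IsMaxMatching {n} {r} adj M =
  IsMatchingIn adj n M × (∀ M′ → IsMatchingIn adj n M′ → size M′ ≤ size M)

V : ℕ → ℕ → Set
V n r = Fin n ⊎ Fin r

Adj : ∀ {n r} → (Fin n → Fin r → Bool) → ℕ → V n r → V n r → Set
Adj adj t (inj₁ l) (inj₂ x) = (toℕ l < t) × (adj l x ≡ true)
Adj adj t (inj₂ x) (inj₁ l) = (toℕ l < t) × (adj l x ≡ true)
Adj adj t (inj₁ _) (inj₁ _) = ⊥
Adj adj t (inj₂ _) (inj₂ _) = ⊥

Covered : ∀ {n r} → EdgeSet n r → V n r → Set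
Covered M (inj₁ l) = ∃[ x ] (M l x ≡ true)
Covered M (inj₂ x) = ∃[ l ] (M l x ≡ true)

pairs : ∀ {A : Set} → List A → List (A × A)
pairs [] = []
pairs (a ∷ []) = []
pairs (a ∷ b ∷ rest) = (a , b) ∷ pairs (b ∷ rest)

inES : ∀ {n r} → EdgeSet n r → V n r × V n r → Bool
inES M (inj₁ l , inj₂ x) = M l x
inES M (inj₂ x , inj₁ l) = M l x
inES M (inj₁ _ , inj₁ _) = false
inES M (inj₂ _ , inj₂ _) = false

Alternating : ∀ {n r} → EdgeSet n r → Bool → List (V n r × V n r) → Set
Alternating M b [] = ⊤
Alternating M b (e ∷ es) = (inES M e ≡ b) × Alternating M (not b) es

pathLen : ∀ {A : Set} → List A → ℕ
pathLen P = length P ∸ 1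

record AugPath {n r : ℕ} (adj : Fin n → Fin r → Bool) (t : ℕ) (M : EdgeSet n r)
               (P : List (V n r)) : Set where
  field
    start end : V n r
    middle    : List (V n r)
    shape     : P ≡ start ∷ (middle ++ [ end ])
    distinct  : Unique P
    isPath    : Linked (Adj adj t) P
    alt       : Alternating M false (pairs P)
    startFree : ¬ Covered M start
    endFree   : ¬ Covered M end

isEdge : ∀ {n r} → Fin n → Fin r → V n r × V n r → Bool
isEdge l x (inj₁ l′ , inj₂ x′) = ⌊ l ≟ l′ ⌋ ∧ ⌊ x ≟ x′ ⌋
isEdge l x (inj₂ x′ , inj₁ l′) = ⌊ l ≟ l′ ⌋ ∧ ⌊ x ≟ x′ ⌋
isEdge l x (inj₁ _ , inj₁ _) = false
isEdge l x (inj₂ _ , inj₂ _) = false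

pathES : ∀ {n r} → List (V n r) → EdgeSet n r
pathES P l x = any (isEdge l x) (pairs P)

_△_ : ∀ {n r} → EdgeSet n r → List (V n r) → EdgeSet n r
(M △ P) l x = M l x xor pathES P l x

-- one timestep of the algorithm with budget k, when left vertex l arrives
-- (the current graph then contains the left vertices with index ≤ toℕ l).
-- Ties between shortest augmenting paths may be broken arbitrarily.
data Step {n r : ℕ} (adj : Fin n → Fin r → Bool) (k : ℕ) (l : Fin n)
          (M : EdgeSet n r) : EdgeSet n r → Set where
  augment : (P : List (V n r)) →
            AugPath adj (suc (toℕ l)) M P → inj₁ l ∈ P →
            (∀ Q → AugPath adj (suc (toℕ l)) M Q → inj₁ l ∈ Q → pathLen P ≤ pathLen Q) →
            pathLen P ≤ k ∸ 1 →
            Step adj k l M (M △ P)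
  idle    : (∀ Q → AugPath adj (suc (toℕ l)) M Q → inj₁ l ∈ Q → k ∸ 1 < pathLen Q) →
            Step adj k l M M

-- Ms t is the matching output at the end of timestep t (Ms 0 = ∅);
-- the final matching is Ms n.
IsRun : ∀ {n r} → (Fin n → Fin r → Bool) → ℕ → (ℕ → EdgeSet n r) → Set
IsRun {n} {r} adj k Ms =
  (∀ l x → Ms 0 l x ≡ false) ×
  (∀ (l : Fin n) → Step adj k l (Ms (toℕ l)) (Ms (suc (toℕ l))))

-- Invariant: after every arrival the matching M has no augmenting path of length < k in the current
-- graph. Augmenting along a shortest augmenting path P through the new vertex u keeps it: for an
-- augmenting path P′ of M △ P, the edge set M ⊕ ((M △ P) △ P′) has at most |P| + |P′| edges and contains
-- two vertex-disjoint augmenting paths of M; at most one of them passes through u, so it has length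
-- at least |P|, and the other avoids u, lies in the previous graph and has length at least k.
-- Hence |P′| ≥ k. Augmenting paths have odd length and k is even, so at the end they all have length
-- at least k + 1, while M ⊕ M_opt contains |M_opt| − |M| disjoint ones with at most |M| + |M_opt|
-- edges in total: (|M_opt| − |M|)(k + 1) ≤ 2|M| + (|M_opt| − |M|), that is k |M_opt| ≤ (k + 2) |M|.
-- Disjoint augmenting paths of M inside M ⊕ N (|M| < |N|) are found one at a time, each by induction
-- on |M ⊕ N|.

module Submission where

open import Defs
open import Algebra.Properties.CommutativeSemigroup using (interchange)
open import Data.Bool using (Bool; true; false; _xor_; _∧_; _∨_; not; if_then_else_)
open import Data.Bool.ListAction using (any)
open import Data.Bool.Properties
  using (∧-zeroʳ; ∧-identityʳ; not-involutive; not-distribˡ-xor; ¬-not; xor-identityʳ; T-≡)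
  renaming (_≟_ to _≟ᵇ_)
open import Data.Empty using (⊥; ⊥-elim)
open import Data.Fin using (Fin; toℕ; zero; suc; fromℕ<)
open import Data.Fin.Properties using (_≟_; any?; all?; toℕ-injective; toℕ-fromℕ<) renaming (suc-injective to Fin-suc-injective)
open import Data.List using (List; []; _∷_; _++_; [_]; length; map; allFin; tabulate)
open import Data.List.Membership.Propositional using (_∈_; _∉_; find; lose)
open import Data.List.Properties using (map-tabulate)
open import Data.List.Relation.Unary.All using (All; []; _∷_; lookup) renaming (map to All-map)
open import Data.List.Relation.Unary.All.Properties.Core using (All¬⇒¬Any; ¬Any⇒All¬)
open import Data.List.Relation.Unary.AllPairs using (AllPairs; []; _∷_)
open import Data.List.Relation.Unary.Any using (here; there)
open import Data.List.Relation.Unary.Any.Properties using (any⁺; any⁻)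
open import Data.List.Relation.Unary.Linked using (Linked; []; [-]; _∷_)
open import Data.List.Relation.Unary.Unique.Propositional using (Unique)
open import Data.List.Relation.Binary.Disjoint.Propositional using (Disjoint)
open import Data.Nat using (ℕ; zero; suc; _+_; _*_; _∸_; _≤_; _<_; z≤n; s≤s; _<?_)
open import Data.Nat.Divisibility using (_∣_; ∣1⇒≡1; ∣m+n∣m⇒∣n; m∣m*n)
open import Data.Nat.ListAction using (sum)
open import Data.Nat.Properties hiding (_≟_; ≟-diag)
open import Data.Nat.Tactic.RingSolver using (solve-∀)
open import Data.Product using (_×_; _,_; ∃-syntax; proj₁; proj₂)
open import Data.Sum using (_⊎_; inj₁; inj₂)
open import Data.Sum.Properties using (≡-dec; inj₁-injective)
open import Data.Unit using (tt)
open import Function using (_∘_; id; Equivalence)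
open import Relation.Nullary using (¬_; yes; no; Dec)
open import Relation.Nullary.Decidable using (⌊_⌋; isYes≗does; dec-true; _×-dec_)
open import Relation.Binary.PropositionalEquality hiding ([_])

private variable
  n r : ℕ

true≢false : ¬ true ≡ false
true≢false ()

≟-true⇒≡ : ∀ {m} (a b : Fin m) → ⌊ a ≟ b ⌋ ≡ true → a ≡ b
≟-true⇒≡ a b eq with a ≟ b
... | yes a≡b = a≡b

≟-diag : ∀ {m} (a : Fin m) → ⌊ a ≟ a ⌋ ≡ true
≟-diag a = trans (isYes≗does (a ≟ a)) (dec-true (a ≟ a) refl)

∸1<⇒≤ : ∀ {k m} → 0 < k → k ∸ 1 < m → k ≤ m
∸1<⇒≤ {suc k} _ = id

⟦_⟧ : Bool → ℕ
⟦ b ⟧ = if b then 1 else 0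

⟦⟧≤1 : ∀ b → ⟦ b ⟧ ≤ 1
⟦⟧≤1 true = s≤s z≤n
⟦⟧≤1 false = z≤n

Σ : ∀ m → (Fin m → ℕ) → ℕ
Σ zero f = 0
Σ (suc m) f = f zero + Σ m (f ∘ suc)

sum-map-allFin : ∀ m (f : Fin m → ℕ) → sum (map f (allFin m)) ≡ Σ m f
sum-map-allFin m f = trans (cong sum (map-tabulate id f)) (sum-tabulate m f)
  where
  sum-tabulate : ∀ m (f : Fin m → ℕ) → sum (tabulate f) ≡ Σ m f
  sum-tabulate zero f = refl
  sum-tabulate (suc m) f = cong (f zero +_) (sum-tabulate m (f ∘ suc))

Σ-cong : ∀ m {f g : Fin m → ℕ} → (∀ i → f i ≡ g i) → Σ m f ≡ Σ m g
Σ-cong zero e = refl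
Σ-cong (suc m) e = cong₂ _+_ (e zero) (Σ-cong m (e ∘ suc))

Σ-mono-≤ : ∀ m {f g : Fin m → ℕ} → (∀ i → f i ≤ g i) → Σ m f ≤ Σ m g
Σ-mono-≤ zero e = z≤n
Σ-mono-≤ (suc m) e = +-mono-≤ (e zero) (Σ-mono-≤ m (e ∘ suc))

Σ-distrib-+ : ∀ m (f g : Fin m → ℕ) → Σ m (λ i → f i + g i) ≡ Σ m f + Σ m g
Σ-distrib-+ zero f g = refl
Σ-distrib-+ (suc m) f g =
  trans (cong (f zero + g zero +_) (Σ-distrib-+ m (f ∘ suc) (g ∘ suc)))
        (interchange +-commutativeSemigroup (f zero) (g zero) _ _)

Σ-zero : ∀ m {f : Fin m → ℕ} → (∀ i → f i ≡ 0) → Σ m f ≡ 0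
Σ-zero zero e = refl
Σ-zero (suc m) e = cong₂ _+_ (e zero) (Σ-zero m (e ∘ suc))

Σ-single : ∀ m {f : Fin m → ℕ} (a : Fin m) → (∀ i → ¬ i ≡ a → f i ≡ 0) → Σ m f ≡ f a
Σ-single (suc m) {f} zero e = trans (cong (f zero +_) (Σ-zero m (λ i → e (suc i) λ ()))) (+-identityʳ _)
Σ-single (suc m) (suc a) e = cong₂ _+_ (e zero λ ()) (Σ-single m a λ i i≢a → e (suc i) (i≢a ∘ Fin-suc-injective))

f≤Σ : ∀ m (f : Fin m → ℕ) (a : Fin m) → f a ≤ Σ m f
f≤Σ (suc m) f zero = m≤m+n _ _
f≤Σ (suc m) f (suc a) = ≤-trans (f≤Σ m (f ∘ suc) a) (m≤n+m _ _)

Σ-≤1 : ∀ m (f : Fin m → ℕ) → (∀ i → f i ≤ 1) → (∀ i j → 0 < f i → 0 < f j → i ≡ j) → Σ m f ≤ 1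
Σ-≤1 m f f≤1 unique with any? (λ i → 0 <? f i)
... | yes (a , 0<fa) = ≤-trans (≤-reflexive (Σ-single m a vanish)) (f≤1 a)
  where
  vanish : ∀ i → ¬ i ≡ a → f i ≡ 0
  vanish i i≢a = n≤0⇒n≡0 (≮⇒≥ λ 0<fi → i≢a (unique i a 0<fi 0<fa))
... | no none = ≤-trans (≤-reflexive (Σ-zero m λ i → n≤0⇒n≡0 (≮⇒≥ λ 0<fi → none (i , 0<fi)))) z≤n

total : (Fin n → Fin r → ℕ) → ℕ
total {n} {r} f = Σ n (λ l → Σ r (f l))

total-cong : {f g : Fin n → Fin r → ℕ} → (∀ l x → f l x ≡ g l x) → total f ≡ total g
total-cong {n} {r} e = Σ-cong n (λ l → Σ-cong r (e l))

total-mono-≤ : {f g : Fin n → Fin r → ℕ} → (∀ l x → f l x ≤ g l x) → total f ≤ total g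
total-mono-≤ {n} {r} e = Σ-mono-≤ n (λ l → Σ-mono-≤ r (e l))

total-distrib-+ : (f g : Fin n → Fin r → ℕ) → total (λ l x → f l x + g l x) ≡ total f + total g
total-distrib-+ {n} {r} f g = trans (Σ-cong n (λ l → Σ-distrib-+ r (f l) (g l))) (Σ-distrib-+ n _ _)

total-single : {f : Fin n → Fin r → ℕ} (a : Fin n) (b : Fin r) →
               (∀ l x → ¬ (l ≡ a × x ≡ b) → f l x ≡ 0) → total f ≡ f a b
total-single {n} {r} a b e =
  trans (Σ-single n a (λ l l≢a → Σ-zero r (λ x → e l x (l≢a ∘ proj₁))))
        (Σ-single r b (λ x x≢b → e a x (x≢b ∘ proj₂)))

size≡total : (M : EdgeSet n r) → size M ≡ total (λ l x → ⟦ M l x ⟧)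
size≡total {n} {r} M = trans (sum-map-allFin n _) (Σ-cong n (λ l → sum-map-allFin r _))

size-cong : {A B : EdgeSet n r} → (∀ l x → A l x ≡ B l x) → size A ≡ size B
size-cong {A = A} {B} A≗B = trans (size≡total A) (trans (total-cong λ l x → cong ⟦_⟧ (A≗B l x)) (sym (size≡total B)))

size-+ : (A B : EdgeSet n r) → total (λ l x → ⟦ A l x ⟧ + ⟦ B l x ⟧) ≡ size A + size B
size-+ A B = trans (total-distrib-+ (λ l x → ⟦ A l x ⟧) (λ l x → ⟦ B l x ⟧))
                   (sym (cong₂ _+_ (size≡total A) (size≡total B)))

module _ {n r : ℕ} where

  complete : EdgeSet n r
  complete _ _ = true

  Crossing : V n r × V n r → Set
  Crossing e = inES complete e ≡ true

  inES⇒crossing : ∀ (X : EdgeSet n r) e → inES X e ≡ true → Crossing e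
  inES⇒crossing X (inj₁ _ , inj₂ _) _ = refl
  inES⇒crossing X (inj₂ _ , inj₁ _) _ = refl

  inES-sym : ∀ (X : EdgeSet n r) v w → inES X (v , w) ≡ inES X (w , v)
  inES-sym X (inj₁ _) (inj₁ _) = refl
  inES-sym X (inj₁ _) (inj₂ _) = refl
  inES-sym X (inj₂ _) (inj₁ _) = refl
  inES-sym X (inj₂ _) (inj₂ _) = refl

  inES-mono : {A B : EdgeSet n r} → (∀ l x → A l x ≡ true → B l x ≡ true) →
              ∀ e → inES A e ≡ true → inES B e ≡ true
  inES-mono h (inj₁ l , inj₂ x) = h l x
  inES-mono h (inj₂ x , inj₁ l) = h l x

  inES-disjoint : {A B : EdgeSet n r} → (∀ l x → A l x ≡ true → B l x ≡ false) →
                  ∀ e → inES A e ≡ true → inES B e ≡ false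
  inES-disjoint h (inj₁ l , inj₂ x) = h l x
  inES-disjoint h (inj₂ x , inj₁ l) = h l x

  inES-agree : {X Y Z : EdgeSet n r} → (∀ l x → Z l x ≡ true → X l x ≡ Y l x) →
               ∀ e → inES Z e ≡ true → inES X e ≡ inES Y e
  inES-agree h (inj₁ l , inj₂ x) = h l x
  inES-agree h (inj₂ x , inj₁ l) = h l x

  IsMatching : EdgeSet n r → Set
  IsMatching X = ∀ v w w′ → inES X (v , w) ≡ true → inES X (v , w′) ≡ true → w ≡ w′

  Covers : EdgeSet n r → V n r → Set
  Covers X v = ∃[ w ] (inES X (v , w) ≡ true)

  covered⇒covers : ∀ (X : EdgeSet n r) v → Covered X v → Covers X v
  covered⇒covers X (inj₁ l) (x , e) = inj₂ x , e
  covered⇒covers X (inj₂ x) (l , e) = inj₁ l , e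

  covers⇒covered : ∀ (X : EdgeSet n r) v → Covers X v → Covered X v
  covers⇒covered X (inj₁ l) (inj₂ x , e) = x , e
  covers⇒covered X (inj₂ x) (inj₁ l , e) = l , e

  module _ {X : EdgeSet n r} (matching : IsMatching X) where

    matching-row : ∀ l x x′ → X l x ≡ true → X l x′ ≡ true → x ≡ x′
    matching-row l x x′ p q with matching (inj₁ l) (inj₂ x) (inj₂ x′) p q
    ... | refl = refl

    matching-col : ∀ l l′ x → X l x ≡ true → X l′ x ≡ true → l ≡ l′
    matching-col l l′ x p q with matching (inj₂ x) (inj₁ l) (inj₁ l′) p q
    ... | refl = refl

  row-col⇒matching : {X : EdgeSet n r} →
                     (∀ l x x′ → X l x ≡ true → X l x′ ≡ true → x ≡ x′) →
                     (∀ l l′ x → X l x ≡ true → X l′ x ≡ true → l ≡ l′) → IsMatching X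
  row-col⇒matching row col (inj₁ l) (inj₂ x) (inj₂ x′) p q = cong inj₂ (row l x x′ p q)
  row-col⇒matching row col (inj₂ x) (inj₁ l) (inj₁ l′) p q = cong inj₁ (col l l′ x p q)

  _⊕_ : EdgeSet n r → EdgeSet n r → EdgeSet n r
  (M ⊕ N) l x = M l x xor N l x

  size-⊕-≤ : ∀ (A B : EdgeSet n r) → size (A ⊕ B) ≤ size A + size B
  size-⊕-≤ A B = subst₂ _≤_ (sym (size≡total (A ⊕ B))) (size-+ A B) (total-mono-≤ λ l x → ⟦xor⟧≤ (A l x) (B l x))
    where
    ⟦xor⟧≤ : ∀ a b → ⟦ a xor b ⟧ ≤ ⟦ a ⟧ + ⟦ b ⟧
    ⟦xor⟧≤ true true = z≤n
    ⟦xor⟧≤ true false = ≤-refl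
    ⟦xor⟧≤ false b = ≤-refl

module _ {n r : ℕ} where

  _≟V_ : (u v : V n r) → Dec (u ≡ v)
  _≟V_ = ≡-dec _≟_ _≟_

  open import Data.List.Membership.DecPropositional _≟V_ public using (_∈?_)

  Consecutive : List (V n r) → V n r → V n r → Set
  Consecutive xs v w = ((v , w) ∈ pairs xs) ⊎ ((w , v) ∈ pairs xs)

  lastV : V n r → List (V n r) → V n r
  lastV v [] = v
  lastV v (w ∷ ws) = lastV w ws

  ∈-pairs⇒∈ : ∀ {a b} (xs : List (V n r)) → (a , b) ∈ pairs xs → (a ∈ xs) × (b ∈ xs)
  ∈-pairs⇒∈ (p ∷ q ∷ rest) (here refl) = here refl , there (here refl)
  ∈-pairs⇒∈ (p ∷ q ∷ rest) (there m) with ∈-pairs⇒∈ (q ∷ rest) m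
  ... | a∈ , b∈ = there a∈ , there b∈

  consecutive⇒∈ : ∀ {v w} (xs : List (V n r)) → Consecutive xs v w → v ∈ xs
  consecutive⇒∈ xs (inj₁ m) = proj₁ (∈-pairs⇒∈ xs m)
  consecutive⇒∈ xs (inj₂ m) = proj₂ (∈-pairs⇒∈ xs m)

  consecutive-∷ : ∀ {p v w} (xs : List (V n r)) → Consecutive xs v w → Consecutive (p ∷ xs) v w
  consecutive-∷ (q ∷ rest) (inj₁ m) = inj₁ (there m)
  consecutive-∷ (q ∷ rest) (inj₂ m) = inj₂ (there m)

  consecutive-head : ∀ {q s w} (rest : List (V n r)) → Unique (q ∷ s ∷ rest) →
                     Consecutive (q ∷ s ∷ rest) q w → w ≡ s
  consecutive-head rest u (inj₁ (here refl)) = refl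
  consecutive-head rest (q∉ ∷ _) (inj₁ (there m)) = ⊥-elim (All¬⇒¬Any q∉ (proj₁ (∈-pairs⇒∈ _ m)))
  consecutive-head rest ((q≢s ∷ _) ∷ _) (inj₂ (here refl)) = ⊥-elim (q≢s refl)
  consecutive-head rest (q∉ ∷ _) (inj₂ (there m)) = ⊥-elim (All¬⇒¬Any q∉ (proj₂ (∈-pairs⇒∈ _ m)))

  consecutive-exists : ∀ s (mid : List (V n r)) e v → v ∈ (s ∷ mid ++ [ e ]) →
                       ∃[ w ] Consecutive (s ∷ mid ++ [ e ]) v w
  consecutive-exists s [] e v (here refl) = e , inj₁ (here refl)
  consecutive-exists s [] e v (there (here refl)) = s , inj₂ (here refl)
  consecutive-exists s (m ∷ mid) e v (here refl) = m , inj₁ (here refl)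
  consecutive-exists s (m ∷ mid) e v (there v∈) with consecutive-exists m mid e v v∈
  ... | w , c = w , consecutive-∷ (m ∷ mid ++ [ e ]) c

any≡true⇒∈ : {A : Set} (f : A → Bool) (xs : List A) → any f xs ≡ true → ∃[ e ] (e ∈ xs × f e ≡ true)
any≡true⇒∈ f xs any≡true with find (any⁻ f xs (Equivalence.from T-≡ any≡true))
... | e , e∈ , fe = e , e∈ , Equivalence.to T-≡ fe

∈⇒any≡true : {A : Set} (f : A → Bool) {e : A} (xs : List A) → e ∈ xs → f e ≡ true → any f xs ≡ true
∈⇒any≡true f xs e∈ fe = Equivalence.to T-≡ (any⁺ f (lose e∈ (Equivalence.from T-≡ fe)))

module _ {n r : ℕ} where

  single : Fin n → Fin r → EdgeSet n r
  single a b l x = ⌊ l ≟ a ⌋ ∧ ⌊ x ≟ b ⌋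

  single-true : ∀ {a b l x} → single a b l x ≡ true → l ≡ a × x ≡ b
  single-true {a} {b} {l} {x} eq with l ≟ a | x ≟ b
  ... | yes l≡a | yes x≡b = l≡a , x≡b

  single-diag : ∀ a b → single a b a b ≡ true
  single-diag a b = cong₂ _∧_ (≟-diag a) (≟-diag b)

  total-∧-single : ∀ (X : EdgeSet n r) a b → total (λ l x → ⟦ X l x ∧ single a b l x ⟧) ≡ ⟦ X a b ⟧
  total-∧-single X a b =
    trans (total-single a b off) (cong ⟦_⟧ (trans (cong (X a b ∧_) (single-diag a b)) (∧-identityʳ _)))
    where
    off : ∀ l x → ¬ (l ≡ a × x ≡ b) → ⟦ X l x ∧ single a b l x ⟧ ≡ 0
    off l x ne with single a b l x in eq
    ... | true = ⊥-elim (ne (single-true eq))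
    ... | false = cong ⟦_⟧ (∧-zeroʳ (X l x))

  size-single : ∀ a b → size (single a b) ≡ 1
  size-single a b = trans (size≡total (single a b)) (total-∧-single complete a b)

  isEdge-shape : ∀ (l : Fin n) (x : Fin r) e → isEdge l x e ≡ true →
                 (e ≡ (inj₁ l , inj₂ x)) ⊎ (e ≡ (inj₂ x , inj₁ l))
  isEdge-shape l x (inj₁ a , inj₂ b) eq with single-true {a} {b} {l} {x} eq
  ... | refl , refl = inj₁ refl
  isEdge-shape l x (inj₂ b , inj₁ a) eq with single-true {a} {b} {l} {x} eq
  ... | refl , refl = inj₂ refl

  isEdge-inES : ∀ (Z : EdgeSet n r) l x e → isEdge l x e ≡ true → inES Z e ≡ Z l x
  isEdge-inES Z l x e eq with isEdge-shape l x e eq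
  ... | inj₁ refl = refl
  ... | inj₂ refl = refl

  Edges : EdgeSet n r → List (V n r) → Set
  Edges Z Q = All (λ e → inES Z e ≡ true) (pairs Q)

  pathES-⊆ : ∀ {Z} Q → Edges Z Q → ∀ l x → pathES Q l x ≡ true → Z l x ≡ true
  pathES-⊆ {Z} Q edges l x eq with any≡true⇒∈ (isEdge l x) (pairs Q) eq
  ... | e , e∈ , edge = trans (sym (isEdge-inES Z l x e edge)) (lookup edges e∈)

  edges-consecutive : ∀ {Z v w} Q → Edges Z Q → Consecutive Q v w → inES Z (v , w) ≡ true
  edges-consecutive Q edges (inj₁ m) = lookup edges m
  edges-consecutive {Z} {v} {w} Q edges (inj₂ m) = trans (inES-sym Z v w) (lookup edges m)

  pathES⇒consecutive : ∀ (Q : List (V n r)) v w → inES (pathES Q) (v , w) ≡ true → Consecutive Q v w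
  pathES⇒consecutive Q (inj₁ l) (inj₂ x) eq with any≡true⇒∈ (isEdge l x) (pairs Q) eq
  ... | e , e∈ , edge with isEdge-shape l x e edge
  ...   | inj₁ refl = inj₁ e∈
  ...   | inj₂ refl = inj₂ e∈
  pathES⇒consecutive Q (inj₂ x) (inj₁ l) eq with any≡true⇒∈ (isEdge l x) (pairs Q) eq
  ... | e , e∈ , edge with isEdge-shape l x e edge
  ...   | inj₁ refl = inj₂ e∈
  ...   | inj₂ refl = inj₁ e∈

  consecutive⇒pathES : ∀ (Q : List (V n r)) v w → Consecutive Q v w → Crossing (v , w) →
                       inES (pathES Q) (v , w) ≡ true
  consecutive⇒pathES Q (inj₁ l) (inj₂ x) (inj₁ m) _ = ∈⇒any≡true (isEdge l x) (pairs Q) m (single-diag l x)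
  consecutive⇒pathES Q (inj₁ l) (inj₂ x) (inj₂ m) _ = ∈⇒any≡true (isEdge l x) (pairs Q) m (single-diag l x)
  consecutive⇒pathES Q (inj₂ x) (inj₁ l) (inj₁ m) _ = ∈⇒any≡true (isEdge l x) (pairs Q) m (single-diag l x)
  consecutive⇒pathES Q (inj₂ x) (inj₁ l) (inj₂ m) _ = ∈⇒any≡true (isEdge l x) (pairs Q) m (single-diag l x)

  pathES-∉ : ∀ (Q : List (V n r)) v w → v ∉ Q → inES (pathES Q) (v , w) ≡ false
  pathES-∉ Q v w v∉ with inES (pathES Q) (v , w) in eq
  ... | false = refl
  ... | true = ⊥-elim (v∉ (consecutive⇒∈ Q (pathES⇒consecutive Q v w eq)))

  count : EdgeSet n r → List (V n r × V n r) → ℕ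
  count X es = sum (map (λ e → ⟦ inES X e ⟧) es)

  total-∧-false : ∀ (X : EdgeSet n r) → total (λ l x → ⟦ X l x ∧ false ⟧) ≡ 0
  total-∧-false X = trans (total-cong λ l x → cong ⟦_⟧ (∧-zeroʳ (X l x))) (Σ-zero n λ _ → Σ-zero r λ _ → refl)

  total-∧-isEdge : ∀ (X : EdgeSet n r) e → total (λ l x → ⟦ X l x ∧ isEdge l x e ⟧) ≡ ⟦ inES X e ⟧
  total-∧-isEdge X (inj₁ a , inj₂ b) = total-∧-single X a b
  total-∧-isEdge X (inj₂ b , inj₁ a) = total-∧-single X a b
  total-∧-isEdge X (inj₁ _ , inj₁ _) = total-∧-false X
  total-∧-isEdge X (inj₂ _ , inj₂ _) = total-∧-false X

  total-∧-pathES : ∀ (X : EdgeSet n r) (Q : List (V n r)) → Unique Q →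
                   total (λ l x → ⟦ X l x ∧ pathES Q l x ⟧) ≡ count X (pairs Q)
  total-∧-pathES X [] _ = total-∧-false X
  total-∧-pathES X (p ∷ []) _ = total-∧-false X
  total-∧-pathES X (p ∷ q ∷ rest) (p∉ ∷ unique) = begin
    total (λ l x → ⟦ X l x ∧ (isEdge l x (p , q) ∨ pathES (q ∷ rest) l x) ⟧)
      ≡⟨ total-cong (λ l x → ⟦∧∨⟧ (X l x) _ _ (disjoint l x)) ⟩
    total (λ l x → ⟦ X l x ∧ isEdge l x (p , q) ⟧ + ⟦ X l x ∧ pathES (q ∷ rest) l x ⟧)
      ≡⟨ total-distrib-+ (λ l x → ⟦ X l x ∧ isEdge l x (p , q) ⟧) (λ l x → ⟦ X l x ∧ pathES (q ∷ rest) l x ⟧) ⟩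
    total (λ l x → ⟦ X l x ∧ isEdge l x (p , q) ⟧) + total (λ l x → ⟦ X l x ∧ pathES (q ∷ rest) l x ⟧)
      ≡⟨ cong₂ _+_ (total-∧-isEdge X (p , q)) (total-∧-pathES X (q ∷ rest) unique) ⟩
    count X (pairs (p ∷ q ∷ rest)) ∎
    where
    open ≡-Reasoning
    ⟦∧∨⟧ : ∀ a b c → ¬ (b ≡ true × c ≡ true) → ⟦ a ∧ (b ∨ c) ⟧ ≡ ⟦ a ∧ b ⟧ + ⟦ a ∧ c ⟧
    ⟦∧∨⟧ false b c _ = refl
    ⟦∧∨⟧ true true true both = ⊥-elim (both (refl , refl))
    ⟦∧∨⟧ true true false _ = refl
    ⟦∧∨⟧ true false c _ = refl
    disjoint : ∀ l x → ¬ (isEdge l x (p , q) ≡ true × pathES (q ∷ rest) l x ≡ true)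
    disjoint l x (first , later) with any≡true⇒∈ (isEdge l x) (pairs (q ∷ rest)) later
    ... | e , e∈ , edge with ∈-pairs⇒∈ (q ∷ rest) e∈ | isEdge-shape l x e edge | isEdge-shape l x (p , q) first
    ...   | u∈ , _ | inj₁ refl | inj₁ refl = All¬⇒¬Any p∉ u∈
    ...   | _ , w∈ | inj₁ refl | inj₂ refl = All¬⇒¬Any p∉ w∈
    ...   | _ , w∈ | inj₂ refl | inj₁ refl = All¬⇒¬Any p∉ w∈
    ...   | u∈ , _ | inj₂ refl | inj₂ refl = All¬⇒¬Any p∉ u∈

  size-pathES : ∀ (Q : List (V n r)) → Unique Q → All Crossing (pairs Q) → size (pathES Q) ≡ length (pairs Q)
  size-pathES Q unique crossing =
    trans (size≡total (pathES Q)) (trans (total-∧-pathES complete Q unique) (count-complete (pairs Q) crossing))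
    where
    count-complete : ∀ es → All Crossing es → count complete es ≡ length es
    count-complete [] [] = refl
    count-complete (e ∷ es) (c ∷ cs) rewrite c = cong suc (count-complete es cs)

  size-△-count : ∀ (M : EdgeSet n r) (Q : List (V n r)) → Unique Q →
                 size (M △ Q) + (count M (pairs Q) + count M (pairs Q)) ≡ size M + size (pathES Q)
  size-△-count M Q unique = begin
    size (M △ Q) + (count M (pairs Q) + count M (pairs Q))
      ≡⟨ cong₂ _+_ (size≡total (M △ Q)) (sym (cong₂ _+_ (total-∧-pathES M Q unique) (total-∧-pathES M Q unique))) ⟩
    total (λ l x → ⟦ (M △ Q) l x ⟧) + (total both + total both)
      ≡⟨ cong (total (λ l x → ⟦ (M △ Q) l x ⟧) +_) (sym (total-distrib-+ both both)) ⟩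
    total (λ l x → ⟦ (M △ Q) l x ⟧) + total (λ l x → both l x + both l x)
      ≡⟨ sym (total-distrib-+ (λ l x → ⟦ (M △ Q) l x ⟧) (λ l x → both l x + both l x)) ⟩
    total (λ l x → ⟦ M l x xor pathES Q l x ⟧ + (both l x + both l x))
      ≡⟨ total-cong (λ l x → ⟦xor⟧+2⟦∧⟧ (M l x) (pathES Q l x)) ⟩
    total (λ l x → ⟦ M l x ⟧ + ⟦ pathES Q l x ⟧)
      ≡⟨ size-+ M (pathES Q) ⟩
    size M + size (pathES Q) ∎
    where
    open ≡-Reasoning
    both : Fin n → Fin r → ℕ
    both l x = ⟦ M l x ∧ pathES Q l x ⟧
    ⟦xor⟧+2⟦∧⟧ : ∀ a b → ⟦ a xor b ⟧ + (⟦ a ∧ b ⟧ + ⟦ a ∧ b ⟧) ≡ ⟦ a ⟧ + ⟦ b ⟧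
    ⟦xor⟧+2⟦∧⟧ true true = refl
    ⟦xor⟧+2⟦∧⟧ true false = refl
    ⟦xor⟧+2⟦∧⟧ false true = refl
    ⟦xor⟧+2⟦∧⟧ false false = refl

module _ {n r : ℕ} {M : EdgeSet n r} where

  matched-edge-consecutive : IsMatching M → ∀ b v (ws : List (V n r)) z w →
    Alternating M b (pairs (v ∷ ws)) → ¬ Covers M (lastV v ws) → z ∈ (v ∷ ws) →
    (z ≡ v → b ≡ true) → inES M (z , w) ≡ true → Consecutive (v ∷ ws) z w
  matched-edge-consecutive matching b v [] z w _ free (here refl) _ e = ⊥-elim (free (w , e))
  matched-edge-consecutive matching b v (y ∷ rest) z w (s , _) free (here refl) head-matched e
    with matching v y w (trans s (head-matched refl)) e
  ... | refl = inj₁ (here refl)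
  matched-edge-consecutive matching b v (y ∷ rest) z w (s , alt) free (there z∈) _ e with z ≟V y | b
  ... | yes refl | true = inj₂ (here (cong (_, z) (sym (matching z v w (trans (inES-sym M z v) s) e))))
  ... | yes refl | false =
    consecutive-∷ (y ∷ rest) (matched-edge-consecutive matching true y rest z w alt free z∈ (λ _ → refl) e)
  ... | no z≢y | b′ =
    consecutive-∷ (y ∷ rest) (matched-edge-consecutive matching (not b′) y rest z w alt free z∈ (⊥-elim ∘ z≢y) e)

  unmatched-consecutive-exists : ∀ b v y (rest : List (V n r)) z →
    Alternating M b (pairs (v ∷ y ∷ rest)) → ¬ Covers M (lastV y rest) → z ∈ (v ∷ y ∷ rest) →
    (z ≡ v → b ≡ false) → ∃[ w ] (Consecutive (v ∷ y ∷ rest) z w × inES M (z , w) ≡ false)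
  unmatched-consecutive-exists b v y rest z (s , _) _ (here refl) head-unmatched =
    y , inj₁ (here refl) , trans s (head-unmatched refl)
  unmatched-consecutive-exists b v y [] .y _ free (there (here refl)) _ with inES M (y , v) in eq
  ... | true = ⊥-elim (free (v , eq))
  ... | false = v , inj₂ (here refl) , eq
  unmatched-consecutive-exists b v y (y′ ∷ rest) z (s , alt) free (there z∈) _ with z ≟V y | b
  ... | yes refl | false = v , inj₂ (here refl) , trans (inES-sym M z v) s
  ... | yes refl | true with unmatched-consecutive-exists false y y′ rest z alt free z∈ (λ _ → refl)
  ...   | w , c , e = w , consecutive-∷ (y ∷ y′ ∷ rest) c , e
  unmatched-consecutive-exists b v y (y′ ∷ rest) z (s , alt) free (there z∈) _ | no z≢y | b′
    with unmatched-consecutive-exists (not b′) y y′ rest z alt free z∈ (⊥-elim ∘ z≢y)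
  ... | w , c , e = w , consecutive-∷ (y ∷ y′ ∷ rest) c , e

  alternating-head : ∀ {w} b q (rest : List (V n r)) → Unique (q ∷ rest) →
                     Alternating M b (pairs (q ∷ rest)) → Consecutive (q ∷ rest) q w → inES M (q , w) ≡ b
  alternating-head b q [] _ _ (inj₁ ())
  alternating-head b q [] _ _ (inj₂ ())
  alternating-head b q (s ∷ rest) unique (status , _) c with consecutive-head rest unique c
  ... | refl = status

  next-edge-matched : ∀ b p q (rest : List (V n r)) {w} → Unique (q ∷ rest) → inES M (p , q) ≡ b →
    Alternating M (not b) (pairs (q ∷ rest)) → inES M (q , p) ≡ false →
    Consecutive (q ∷ rest) q w → inES M (q , w) ≡ true
  next-edge-matched b p q rest unique s alt f c =
    trans (alternating-head (not b) q rest unique alt c) (cong not (trans (sym s) (trans (inES-sym M p q) f)))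

  unmatched-consecutive-unique : ∀ b (xs : List (V n r)) {v w w′} → Unique xs →
    Alternating M b (pairs xs) → Consecutive xs v w → Consecutive xs v w′ →
    inES M (v , w) ≡ false → inES M (v , w′) ≡ false → w ≡ w′
  unmatched-consecutive-unique b [] _ _ (inj₁ ()) _ _ _
  unmatched-consecutive-unique b [] _ _ (inj₂ ()) _ _ _
  unmatched-consecutive-unique b (p ∷ []) _ _ (inj₁ ()) _ _ _
  unmatched-consecutive-unique b (p ∷ []) _ _ (inj₂ ()) _ _ _
  unmatched-consecutive-unique b (p ∷ q ∷ rest) (p∉ ∷ unique) (s , alt) c c′ f f′
    with split c | split c′
    where
    split : ∀ {v w} → Consecutive (p ∷ q ∷ rest) v w →
            (v ≡ p × w ≡ q) ⊎ (v ≡ q × w ≡ p) ⊎ Consecutive (q ∷ rest) v w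
    split (inj₁ (here refl)) = inj₁ (refl , refl)
    split (inj₂ (here refl)) = inj₂ (inj₁ (refl , refl))
    split (inj₁ (there m)) = inj₂ (inj₂ (inj₁ m))
    split (inj₂ (there m)) = inj₂ (inj₂ (inj₂ m))
  ... | inj₁ (refl , refl) | inj₁ (_ , refl) = refl
  ... | inj₂ (inj₁ (refl , refl)) | inj₂ (inj₁ (_ , refl)) = refl
  ... | inj₂ (inj₂ d) | inj₂ (inj₂ d′) = unmatched-consecutive-unique (not b) (q ∷ rest) unique alt d d′ f f′
  ... | inj₁ (refl , _) | inj₂ (inj₁ (p≡q , _)) = ⊥-elim (All¬⇒¬Any p∉ (here p≡q))
  ... | inj₂ (inj₁ (p≡q , _)) | inj₁ (refl , _) = ⊥-elim (All¬⇒¬Any p∉ (here p≡q))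
  ... | inj₁ (refl , _) | inj₂ (inj₂ d′) = ⊥-elim (All¬⇒¬Any p∉ (consecutive⇒∈ (q ∷ rest) d′))
  ... | inj₂ (inj₂ d) | inj₁ (refl , _) = ⊥-elim (All¬⇒¬Any p∉ (consecutive⇒∈ (q ∷ rest) d))
  ... | inj₂ (inj₁ (refl , refl)) | inj₂ (inj₂ d′) =
    ⊥-elim (true≢false (trans (sym (next-edge-matched b p q rest unique s alt f d′)) f′))
  ... | inj₂ (inj₂ d) | inj₂ (inj₁ (refl , refl)) =
    ⊥-elim (true≢false (trans (sym (next-edge-matched b p q rest unique s alt f′ d)) f))

  alternating-count : ∀ b v y (rest : List (V n r)) →
    Alternating M b (pairs (v ∷ y ∷ rest)) → ¬ Covers M (lastV y rest) →
    2 * count M (pairs (v ∷ y ∷ rest)) + ⟦ not b ⟧ ≡ length (pairs (v ∷ y ∷ rest))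
  alternating-count b v y [] (s , _) free with inES M (v , y) in eq
  ... | true = ⊥-elim (free (v , trans (inES-sym M y v) eq))
  ... | false rewrite sym s = refl
  alternating-count b v y (y′ ∷ rest) (s , alt) free rewrite s =
    step b c (length (pairs (y ∷ y′ ∷ rest)))
      (subst (λ b′ → 2 * c + ⟦ b′ ⟧ ≡ _) (not-involutive b) (alternating-count (not b) y y′ rest alt free))
    where
    c : ℕ
    c = count M (pairs (y ∷ y′ ∷ rest))
    step : ∀ b c L → 2 * c + ⟦ b ⟧ ≡ L → 2 * (⟦ b ⟧ + c) + ⟦ not b ⟧ ≡ suc L
    step true c L refl = ring c
      where
      ring : ∀ c → 2 * (1 + c) + 0 ≡ suc (2 * c + 1)
      ring = solve-∀
    step false c L refl = ring c
      where
      ring : ∀ c → 2 * (0 + c) + 1 ≡ suc (2 * c + 0)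
      ring = solve-∀

-- Augmenting paths

module _ {n r : ℕ} where

  record Augmenting (M : EdgeSet n r) (Q : List (V n r)) : Set where
    field
      start end   : V n r
      middle      : List (V n r)
      shape       : Q ≡ start ∷ (middle ++ [ end ])
      unique      : Unique Q
      alternating : Alternating M false (pairs Q)
      start-free  : ¬ Covers M start
      end-free    : ¬ Covers M end
      crossing    : All Crossing (pairs Q)

  inES-△ : ∀ (M : EdgeSet n r) Q v w → inES (M △ Q) (v , w) ≡ inES M (v , w) xor inES (pathES Q) (v , w)
  inES-△ M Q (inj₁ _) (inj₁ _) = refl
  inES-△ M Q (inj₁ _) (inj₂ _) = refl
  inES-△ M Q (inj₂ _) (inj₁ _) = refl
  inES-△ M Q (inj₂ _) (inj₂ _) = refl

  module _ {M : EdgeSet n r} {Q : List (V n r)} (aug : Augmenting M Q) where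
    open Augmenting aug

    private
      second-and-rest : ∃[ y ] ∃[ rest ] (Q ≡ start ∷ y ∷ rest × lastV y rest ≡ end)
      second-and-rest = split middle shape
        where
        split : ∀ mid → Q ≡ start ∷ (mid ++ [ end ]) → ∃[ y ] ∃[ rest ] (Q ≡ start ∷ y ∷ rest × lastV y rest ≡ end)
        split [] eq = end , [] , eq , refl
        split (m ∷ mid) eq = m , mid ++ [ end ] , eq , last-snoc m mid
          where
          last-snoc : ∀ s mid → lastV s (mid ++ [ end ]) ≡ end
          last-snoc s [] = refl
          last-snoc s (m ∷ mid) = last-snoc m mid

      y : V n r
      y = proj₁ second-and-rest
      rest : List (V n r)
      rest = proj₁ (proj₂ second-and-rest)
      Q≡ : Q ≡ start ∷ y ∷ rest
      Q≡ = proj₁ (proj₂ (proj₂ second-and-rest))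

      alternating′ : Alternating M false (pairs (start ∷ y ∷ rest))
      alternating′ = subst (λ q → Alternating M false (pairs q)) Q≡ alternating

      last-free : ¬ Covers M (lastV y rest)
      last-free = end-free ∘ subst (Covers M) (proj₂ (proj₂ (proj₂ second-and-rest)))

      ∈′ : ∀ {v} → v ∈ Q → v ∈ (start ∷ y ∷ rest)
      ∈′ = subst (_ ∈_) Q≡

      path-edge : ∀ {v w} → Consecutive (start ∷ y ∷ rest) v w → inES (pathES Q) (v , w) ≡ true
      path-edge {v} {w} c = consecutive⇒pathES Q v w c′ (edges-consecutive Q crossing c′)
        where
        c′ : Consecutive Q v w
        c′ = subst (λ q → Consecutive q v w) (sym Q≡) c

    matched-edge-on-path : IsMatching M → ∀ v w → v ∈ Q → inES M (v , w) ≡ true → inES (pathES Q) (v , w) ≡ true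
    matched-edge-on-path matching v w v∈ e =
      path-edge (matched-edge-consecutive matching false start (y ∷ rest) v w alternating′ last-free (∈′ v∈)
                   (λ { refl → ⊥-elim (start-free (w , e)) }) e)

    unmatched-path-edge : ∀ v → v ∈ Q → ∃[ w ] (inES (pathES Q) (v , w) ≡ true × inES M (v , w) ≡ false)
    unmatched-path-edge v v∈ with unmatched-consecutive-exists false start y rest v alternating′ last-free (∈′ v∈) (λ _ → refl)
    ... | w , c , e = w , path-edge c , e

    △-covers-path : ∀ v → v ∈ Q → Covers (M △ Q) v
    △-covers-path v v∈ with unmatched-path-edge v v∈
    ... | w , p , e = w , trans (inES-△ M Q v w) (cong₂ _xor_ e p)

    △-covers : ∀ v → Covers M v → Covers (M △ Q) v
    △-covers v (w , e) with v ∈? Q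
    ... | yes v∈ = △-covers-path v v∈
    ... | no v∉ = w , trans (inES-△ M Q v w) (cong₂ _xor_ e (pathES-∉ Q v w v∉))

    △-isMatching : IsMatching M → IsMatching (M △ Q)
    △-isMatching matching v w w′ p q with v ∈? Q
    ... | no v∉ = matching v w w′ (off p) (off q)
      where
      off : ∀ {w} → inES (M △ Q) (v , w) ≡ true → inES M (v , w) ≡ true
      off {w} p = trans (sym (xor-identityʳ _)) (trans (cong (inES M (v , w) xor_) (sym (pathES-∉ Q v w v∉)))
                    (trans (sym (inES-△ M Q v w)) p))
    ... | yes v∈ = unmatched-consecutive-unique false Q unique alternating
                     (pathES⇒consecutive Q v w (proj₂ (on p))) (pathES⇒consecutive Q v w′ (proj₂ (on q)))
                     (proj₁ (on p)) (proj₁ (on q))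
      where
      on : ∀ {w} → inES (M △ Q) (v , w) ≡ true → inES M (v , w) ≡ false × inES (pathES Q) (v , w) ≡ true
      on {w} p with inES M (v , w) in e1 | inES (pathES Q) (v , w) in e2
      ... | true | _ =
        ⊥-elim (true≢false (trans (sym p) (trans (inES-△ M Q v w) (cong₂ _xor_ e1 (matched-edge-on-path matching v w v∈ e1)))))
      ... | false | true = refl , refl
      ... | false | false = ⊥-elim (true≢false (trans (sym p) (trans (inES-△ M Q v w) (cong₂ _xor_ e1 e2))))

    pathLen≡length-pairs : pathLen Q ≡ length (pairs Q)
    pathLen≡length-pairs rewrite Q≡ = sym (length-pairs start (y ∷ rest))
      where
      length-pairs : ∀ (v : V n r) ws → length (pairs (v ∷ ws)) ≡ length ws
      length-pairs v [] = refl
      length-pairs v (w ∷ ws) = cong suc (length-pairs w ws)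

    pathLen-odd : 2 * count M (pairs Q) + 1 ≡ pathLen Q
    pathLen-odd rewrite pathLen≡length-pairs | Q≡ = alternating-count false start y rest alternating′ last-free

    size-path : size (pathES Q) ≡ pathLen Q
    size-path = trans (size-pathES Q unique crossing) (sym pathLen≡length-pairs)

    size-△ : size (M △ Q) ≡ size M + 1
    size-△ = +-cancelʳ-≡ (c + c) (size (M △ Q)) (size M + 1) (begin
      size (M △ Q) + (c + c)         ≡⟨ size-△-count M Q unique ⟩
      size M + size (pathES Q)       ≡⟨ cong (size M +_) (trans size-path (sym pathLen-odd)) ⟩
      size M + (2 * c + 1)           ≡⟨ ring (size M) c ⟩
      size M + 1 + (c + c)           ∎)
      where
      open ≡-Reasoning
      c : ℕ
      c = count M (pairs Q)
      ring : ∀ m c → m + (2 * c + 1) ≡ m + 1 + (c + c)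
      ring = solve-∀

  size-⊕-△△ : ∀ (M : EdgeSet n r) P P′ → size (M ⊕ ((M △ P) △ P′)) ≤ size (pathES P) + size (pathES P′)
  size-⊕-△△ M P P′ = ≤-trans (≤-reflexive (size-cong λ l x → cancel (M l x) (pathES P l x) (pathES P′ l x)))
                               (size-⊕-≤ (pathES P) (pathES P′))
    where
    cancel : ∀ a b c → a xor ((a xor b) xor c) ≡ b xor c
    cancel true b c = trans (not-distribˡ-xor (not b) c) (cong (_xor c) (not-involutive b))
    cancel false b c = refl

-- Augmenting paths inside the symmetric difference of two matchings

module _ {n r : ℕ} where

  -- Oriented from L to R so that in the rematching step below l′ can only occur as the start.
  record Augmenting⊕ (M N : EdgeSet n r) (Q : List (V n r)) : Set where
    field
      start       : Fin n
      end         : Fin r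
      middle      : List (V n r)
      shape       : Q ≡ inj₁ start ∷ (middle ++ [ inj₂ end ])
      unique      : Unique Q
      alternating : Alternating M false (pairs Q)
      edges       : Edges (M ⊕ N) Q
      start-free  : ¬ Covers M (inj₁ start)
      end-free    : ¬ Covers M (inj₂ end)

  augmenting⊕⇒augmenting : ∀ {M N Q} → Augmenting⊕ M N Q → Augmenting M Q
  augmenting⊕⇒augmenting {M} {N} aug = record
    { start = inj₁ start ; end = inj₂ end ; middle = middle ; shape = shape ; unique = unique
    ; alternating = alternating ; start-free = start-free ; end-free = end-free
    ; crossing = All-map (λ {e} → inES⇒crossing (M ⊕ N) e) edges }
    where open Augmenting⊕ aug

  alternating-agree : ∀ {A B : EdgeSet n r} b (es : List (V n r × V n r)) →
                      All (λ e → inES A e ≡ inES B e) es → Alternating A b es → Alternating B b es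
  alternating-agree b [] [] _ = tt
  alternating-agree b (e ∷ es) (eq ∷ eqs) (s , alt) = trans (sym eq) s , alternating-agree (not b) es eqs alt

  transfer : ∀ {X M N : EdgeSet n r} → (∀ l x → (X ⊕ N) l x ≡ true → X l x ≡ M l x) →
             ∀ Q → Edges (X ⊕ N) Q → Alternating X false (pairs Q) →
             Alternating M false (pairs Q) × Edges (M ⊕ N) Q
  transfer {N = N} agree Q edges alt =
    alternating-agree false (pairs Q) (All-map (λ {e} → inES-agree agree e) edges) alt ,
    All-map (λ {e} p → trans (sym (inES-agree (λ l x q → cong (_xor N l x) (agree l x q)) e p)) p) edges

  two-vertex-path : ∀ (M N : EdgeSet n r) l x → N l x ≡ true → (∀ x′ → M l x′ ≡ false) →
                    (∀ l′ → M l′ x ≡ false) → Augmenting⊕ M N (inj₁ l ∷ inj₂ x ∷ [])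
  two-vertex-path M N l x Nlx l-free x-free = record
    { start = l ; end = x ; middle = [] ; shape = refl
    ; unique = ((λ ()) ∷ []) ∷ [] ∷ []
    ; alternating = l-free x , tt
    ; edges = cong₂ _xor_ (l-free x) Nlx ∷ []
    ; start-free = λ { (inj₂ x′ , p) → true≢false (trans (sym p) (l-free x′)) }
    ; end-free = λ { (inj₁ l′ , p) → true≢false (trans (sym p) (x-free l′)) } }

  -- Rematching x from l′ to l keeps |M| and shrinks M ⊕ N by the edge l x; an augmenting path of the
  -- new matching is one of M as well, after prepending l and x if it starts at the now free l′.
  module Swap {M N : EdgeSet n r} (M-matching : IsMatching M) (N-matching : IsMatching N)
              {l : Fin n} {x : Fin r} (Nlx : N l x ≡ true) (l-free : ∀ x′ → M l x′ ≡ false)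
              {l′ : Fin n} (Ml′x : M l′ x ≡ true) where

    swapped : EdgeSet n r
    swapped l₀ x₀ = if ⌊ x₀ ≟ x ⌋ then ⌊ l₀ ≟ l ⌋ else M l₀ x₀

    private
      swapped-at-x : ∀ l₀ → swapped l₀ x ≡ ⌊ l₀ ≟ l ⌋
      swapped-at-x l₀ with x ≟ x
      ... | yes _ = refl
      ... | no x≢x = ⊥-elim (x≢x refl)

      swapped-off-x : ∀ l₀ x₀ → ¬ x₀ ≡ x → swapped l₀ x₀ ≡ M l₀ x₀
      swapped-off-x l₀ x₀ x₀≢x with x₀ ≟ x
      ... | yes x₀≡x = ⊥-elim (x₀≢x x₀≡x)
      ... | no _ = refl

      l′≢l : ¬ l′ ≡ l
      l′≢l refl = true≢false (trans (sym Ml′x) (l-free x))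

      N-at-x : ∀ l₀ → N l₀ x ≡ true → l₀ ≡ l
      N-at-x l₀ p = matching-col N-matching l₀ l x p Nlx

    swapped-isMatching : IsMatching swapped
    swapped-isMatching = row-col⇒matching row col
      where
      row : ∀ l₀ x₁ x₂ → swapped l₀ x₁ ≡ true → swapped l₀ x₂ ≡ true → x₁ ≡ x₂
      row l₀ x₁ x₂ p q with x₁ ≟ x | x₂ ≟ x
      ... | yes refl | yes refl = refl
      ... | yes refl | no _ with ≟-true⇒≡ l₀ l p
      ...   | refl = ⊥-elim (true≢false (trans (sym q) (l-free x₂)))
      row l₀ x₁ x₂ p q | no _ | yes refl with ≟-true⇒≡ l₀ l q
      ...   | refl = ⊥-elim (true≢false (trans (sym p) (l-free x₁)))
      row l₀ x₁ x₂ p q | no _ | no _ = matching-row M-matching l₀ x₁ x₂ p q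
      col : ∀ l₁ l₂ x₀ → swapped l₁ x₀ ≡ true → swapped l₂ x₀ ≡ true → l₁ ≡ l₂
      col l₁ l₂ x₀ p q with x₀ ≟ x
      ... | yes refl = trans (≟-true⇒≡ l₁ l p) (sym (≟-true⇒≡ l₂ l q))
      ... | no _ = matching-col M-matching l₁ l₂ x₀ p q

    size-swapped : size swapped ≤ size M
    size-swapped = +-cancelʳ-≤ 1 (size swapped) (size M) (begin
      size swapped + 1                                         ≡⟨ cong (size swapped +_) (sym (size-single l′ x)) ⟩
      size swapped + size (single l′ x)                        ≡⟨ sym (size-+ swapped (single l′ x)) ⟩
      total (λ l₀ x₀ → ⟦ swapped l₀ x₀ ⟧ + ⟦ single l′ x l₀ x₀ ⟧) ≤⟨ total-mono-≤ pointwise ⟩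
      total (λ l₀ x₀ → ⟦ M l₀ x₀ ⟧ + ⟦ single l x l₀ x₀ ⟧)       ≡⟨ size-+ M (single l x) ⟩
      size M + size (single l x)                               ≡⟨ cong (size M +_) (size-single l x) ⟩
      size M + 1                                               ∎)
      where
      open ≤-Reasoning
      pointwise : ∀ l₀ x₀ →
                  ⟦ swapped l₀ x₀ ⟧ + ⟦ single l′ x l₀ x₀ ⟧ ≤ ⟦ M l₀ x₀ ⟧ + ⟦ single l x l₀ x₀ ⟧
      pointwise l₀ x₀ with x₀ ≟ x
      ... | no _ = ≤-reflexive (cong (⟦ M l₀ x₀ ⟧ +_)
                     (trans (cong ⟦_⟧ (∧-zeroʳ ⌊ l₀ ≟ l′ ⌋)) (sym (cong ⟦_⟧ (∧-zeroʳ ⌊ l₀ ≟ l ⌋)))))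
      ... | yes refl with l₀ ≟ l | l₀ ≟ l′
      ...   | yes refl | yes refl = ⊥-elim (l′≢l refl)
      ...   | yes refl | no _ rewrite l-free x = ≤-refl
      ...   | no _ | yes refl rewrite Ml′x = ≤-refl
      ...   | no _ | no _ = z≤n

    size-swapped-⊕ : size (swapped ⊕ N) + 1 ≤ size (M ⊕ N)
    size-swapped-⊕ = begin
      size (swapped ⊕ N) + 1                                      ≡⟨ cong (size (swapped ⊕ N) +_) (sym (size-single l x)) ⟩
      size (swapped ⊕ N) + size (single l x)                      ≡⟨ sym (size-+ (swapped ⊕ N) (single l x)) ⟩
      total (λ l₀ x₀ → ⟦ (swapped ⊕ N) l₀ x₀ ⟧ + ⟦ single l x l₀ x₀ ⟧) ≤⟨ total-mono-≤ pointwise ⟩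
      total (λ l₀ x₀ → ⟦ (M ⊕ N) l₀ x₀ ⟧)                           ≡⟨ sym (size≡total (M ⊕ N)) ⟩
      size (M ⊕ N)                                                ∎
      where
      open ≤-Reasoning
      pointwise : ∀ l₀ x₀ → ⟦ (swapped ⊕ N) l₀ x₀ ⟧ + ⟦ single l x l₀ x₀ ⟧ ≤ ⟦ (M ⊕ N) l₀ x₀ ⟧
      pointwise l₀ x₀ with x₀ ≟ x
      ... | no _ =
        ≤-reflexive (trans (cong (⟦ (M ⊕ N) l₀ x₀ ⟧ +_) (cong ⟦_⟧ (∧-zeroʳ ⌊ l₀ ≟ l ⌋))) (+-identityʳ _))
      ... | yes refl with l₀ ≟ l
      ...   | yes refl rewrite Nlx | l-free x = ≤-refl
      ...   | no l₀≢l with N l₀ x in eq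
      ...     | true = ⊥-elim (l₀≢l (N-at-x l₀ eq))
      ...     | false = z≤n

    swapped-agrees : ∀ l₀ x₀ → (swapped ⊕ N) l₀ x₀ ≡ true → swapped l₀ x₀ ≡ M l₀ x₀
    swapped-agrees l₀ x₀ p with x₀ ≟ x
    ... | no _ = refl
    ... | yes refl with l₀ ≟ l
    ...   | yes refl rewrite Nlx = ⊥-elim (true≢false (sym p))
    ...   | no l₀≢l = ⊥-elim (l₀≢l (N-at-x l₀ p))

    covers-swapped : ∀ v → ¬ v ≡ inj₁ l′ → Covers M v → Covers swapped v
    covers-swapped (inj₁ l₀) v≢l′ (inj₂ x₀ , p) with x₀ ≟ x
    ... | yes refl = ⊥-elim (v≢l′ (cong inj₁ (matching-col M-matching l₀ l′ x p Ml′x)))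
    ... | no x₀≢x = inj₂ x₀ , trans (swapped-off-x l₀ x₀ x₀≢x) p
    covers-swapped (inj₂ x₀) _ (inj₁ l₀ , p) with x₀ ≟ x
    ... | yes refl = inj₁ l , trans (swapped-at-x l) (≟-diag l)
    ... | no x₀≢x = inj₁ l₀ , trans (swapped-off-x l₀ x₀ x₀≢x) p

    no-edge-at-l : ∀ w → inES (swapped ⊕ N) (inj₁ l , w) ≡ false
    no-edge-at-l (inj₁ _) = refl
    no-edge-at-l (inj₂ x₀) with x₀ ≟ x
    ... | yes refl rewrite Nlx | ≟-diag l = refl
    ... | no x₀≢x rewrite l-free x₀ with N l x₀ in eq
    ...   | true = ⊥-elim (x₀≢x (matching-row N-matching l x₀ x eq Nlx))
    ...   | false = refl

    no-edge-at-x : ∀ w → inES (swapped ⊕ N) (inj₂ x , w) ≡ false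
    no-edge-at-x (inj₂ _) = refl
    no-edge-at-x (inj₁ l₀) rewrite swapped-at-x l₀ with l₀ ≟ l
    ... | yes refl rewrite Nlx = refl
    ... | no l₀≢l with N l₀ x in eq
    ...   | true = ⊥-elim (l₀≢l (N-at-x l₀ eq))
    ...   | false = refl

    lift : ∀ {Q} → Augmenting⊕ swapped N Q → ∃[ Q′ ] Augmenting⊕ M N Q′
    lift record { start = s ; end = e ; middle = mid ; shape = refl ; unique = unique ; alternating = alt
                ; edges = edges ; start-free = s-free ; end-free = e-free } with s ≟ l′
    ... | no s≢l′ = _ , record
      { start = s ; end = e ; middle = mid ; shape = refl ; unique = unique
      ; alternating = proj₁ transferred ; edges = proj₂ transferred
      ; start-free = s-free ∘ covers-swapped (inj₁ s) (s≢l′ ∘ inj₁-injective)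
      ; end-free = e-free ∘ covers-swapped (inj₂ e) λ () }
      where
      transferred : Alternating M false (pairs (inj₁ s ∷ (mid ++ [ inj₂ e ]))) ×
                    Edges (M ⊕ N) (inj₁ s ∷ (mid ++ [ inj₂ e ]))
      transferred = transfer swapped-agrees (inj₁ s ∷ (mid ++ [ inj₂ e ])) edges alt
    ... | yes refl = inj₁ l ∷ inj₂ x ∷ Q , record
      { start = l ; end = e ; middle = inj₂ x ∷ inj₁ l′ ∷ mid ; shape = refl
      ; unique = ((λ ()) ∷ ¬Any⇒All¬ Q l∉Q) ∷ ¬Any⇒All¬ Q x∉Q ∷ unique
      ; alternating = l-free x , Ml′x , proj₁ transferred
      ; edges = cong₂ _xor_ (l-free x) Nlx ∷ cong₂ _xor_ Ml′x Nl′x ∷ proj₂ transferred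
      ; start-free = λ { (inj₂ x′ , p) → true≢false (trans (sym p) (l-free x′)) }
      ; end-free = e-free ∘ covers-swapped (inj₂ e) λ () }
      where
      Q : List (V n r)
      Q = inj₁ l′ ∷ (mid ++ [ inj₂ e ])
      transferred : Alternating M false (pairs Q) × Edges (M ⊕ N) Q
      transferred = transfer swapped-agrees Q edges alt
      Nl′x : N l′ x ≡ false
      Nl′x with N l′ x in eq
      ... | true = ⊥-elim (l′≢l (N-at-x l′ eq))
      ... | false = refl
      l∉Q : inj₁ l ∉ Q
      l∉Q l∈ with consecutive-exists (inj₁ l′) mid (inj₂ e) (inj₁ l) l∈
      ... | w , c = true≢false (trans (sym (edges-consecutive Q edges c)) (no-edge-at-l w))
      x∉Q : inj₂ x ∉ Q
      x∉Q x∈ with consecutive-exists (inj₁ l′) mid (inj₂ e) (inj₂ x) x∈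
      ... | w , c = true≢false (trans (sym (edges-consecutive Q edges c)) (no-edge-at-x w))

  matching-row-sum : ∀ {N : EdgeSet n r} → IsMatching N → ∀ l → Σ r (λ x → ⟦ N l x ⟧) ≤ 1
  matching-row-sum {N} N-matching l =
    Σ-≤1 r _ (λ x → ⟦⟧≤1 (N l x)) λ x x′ p q → matching-row N-matching l x x′ (positive p) (positive q)
    where
    positive : ∀ {b} → 0 < ⟦ b ⟧ → b ≡ true
    positive {true} _ = refl

  size-≤-rowwise : ∀ {M N : EdgeSet n r} → IsMatching N →
                   (∀ l → ∃[ x ] (N l x ≡ true) → ¬ (∀ x′ → M l x′ ≡ false)) → size N ≤ size M
  size-≤-rowwise {M} {N} N-matching row-covered =
    subst₂ _≤_ (sym (size≡total N)) (sym (size≡total M)) (Σ-mono-≤ n row)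
    where
    row : ∀ l → Σ r (λ x → ⟦ N l x ⟧) ≤ Σ r (λ x → ⟦ M l x ⟧)
    row l with any? (λ x → M l x ≟ᵇ true)
    ... | yes (x′ , Mlx′) =
      ≤-trans (matching-row-sum N-matching l)
              (subst (λ b → ⟦ b ⟧ ≤ Σ r (λ x → ⟦ M l x ⟧)) Mlx′ (f≤Σ r (λ x → ⟦ M l x ⟧) x′))
    ... | no M-free = subst (_≤ Σ r (λ x → ⟦ M l x ⟧)) (sym (Σ-zero r vanish)) z≤n
      where
      vanish : ∀ x → ⟦ N l x ⟧ ≡ 0
      vanish x with N l x in eq
      ... | true = ⊥-elim (row-covered l (x , eq) λ x′ → ¬-not (M-free ∘ (x′ ,_)))
      ... | false = refl

  augmenting⊕-exists : ∀ {M N : EdgeSet n r} → IsMatching M → IsMatching N → size M < size N →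
                       ∃[ Q ] Augmenting⊕ M N Q
  augmenting⊕-exists {M} {N} M-matching N-matching = go (size (M ⊕ N)) M-matching ≤-refl
    where
    go : ∀ d {M} → IsMatching M → size (M ⊕ N) ≤ d → size M < size N → ∃[ Q ] Augmenting⊕ M N Q
    go d {M} M-matching ≤d M<N
      with any? (λ l → any? (λ x → N l x ≟ᵇ true) ×-dec all? (λ x′ → M l x′ ≟ᵇ false))
    ... | no none = ⊥-elim (<⇒≱ M<N (size-≤-rowwise N-matching λ l N-edge l-free → none (l , N-edge , l-free)))
    ... | yes (l , (x , Nlx) , l-free) with any? (λ l′ → M l′ x ≟ᵇ true)
    ...   | no x-free = _ , two-vertex-path M N l x Nlx l-free (λ l′ → ¬-not λ e → x-free (l′ , e))
    ...   | yes (l′ , Ml′x) = recurse d (≤-trans (≤-reflexive (+-comm 1 _)) (≤-trans size-swapped-⊕ ≤d))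
      where
      open Swap M-matching N-matching Nlx l-free Ml′x
      recurse : ∀ d → suc (size (swapped ⊕ N)) ≤ d → ∃[ Q ] Augmenting⊕ M N Q
      recurse (suc d) (s≤s ≤d) = lift (proj₂ (go d swapped-isMatching ≤d (≤-<-trans size-swapped M<N)))

  record AugmentingFamily (M N : EdgeSet n r) (Qs : List (List (V n r))) : Set where
    field
      augmenting   : All (λ Q → Augmenting M Q × Edges (M ⊕ N) Q) Qs
      disjoint     : AllPairs Disjoint Qs
      total-length : sum (map pathLen Qs) ≤ size (M ⊕ N)

  module _ {M N : EdgeSet n r} {Q : List (V n r)} (M-matching : IsMatching M)
           (aug : Augmenting M Q) (edges : Edges (M ⊕ N) Q) where

    private
      on-path⇒⊕ : ∀ l x → pathES Q l x ≡ true → (M ⊕ N) l x ≡ true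
      on-path⇒⊕ = pathES-⊆ Q edges

      flipped : ∀ a c → a xor c ≡ true → (a xor true) xor c ≡ false
      flipped true false _ = refl
      flipped false true _ = refl

      on-path⇒¬△⊕ : ∀ l x → pathES Q l x ≡ true → ((M △ Q) ⊕ N) l x ≡ false
      on-path⇒¬△⊕ l x p rewrite p = flipped (M l x) (N l x) (on-path⇒⊕ l x p)

      △-agrees : ∀ l x → ((M △ Q) ⊕ N) l x ≡ true → (M △ Q) l x ≡ M l x
      △-agrees l x q with pathES Q l x in p
      ... | true = ⊥-elim (true≢false (trans (sym q) (flipped (M l x) (N l x) (on-path⇒⊕ l x p))))
      ... | false = xor-identityʳ (M l x)

    pull-back : ∀ {Q′} → Augmenting (M △ Q) Q′ → Edges ((M △ Q) ⊕ N) Q′ → Augmenting M Q′ × Edges (M ⊕ N) Q′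
    pull-back {Q′} aug′ edges′ = record
      { start = start ; end = end ; middle = middle ; shape = shape ; unique = unique
      ; alternating = proj₁ transferred
      ; start-free = start-free ∘ △-covers aug start
      ; end-free = end-free ∘ △-covers aug end
      ; crossing = crossing } , proj₂ transferred
      where
      open Augmenting aug′
      transferred : Alternating M false (pairs Q′) × Edges (M ⊕ N) Q′
      transferred = transfer △-agrees Q′ edges′ alternating

    disjoint-after : ∀ {Q′} → Augmenting (M △ Q) Q′ → Edges ((M △ Q) ⊕ N) Q′ → Disjoint Q Q′
    disjoint-after {Q′} aug′ edges′ {u} (u∈Q , u∈Q′) with unmatched-path-edge aug u u∈Q
    ... | w , on-Q , unmatched = true≢false (trans (sym in-Q′) (inES-disjoint on-path⇒¬△⊕ (u , w) on-Q))
      where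
      matched-after : inES (M △ Q) (u , w) ≡ true
      matched-after = trans (inES-△ M Q u w) (cong₂ _xor_ unmatched on-Q)
      in-Q′ : inES ((M △ Q) ⊕ N) (u , w) ≡ true
      in-Q′ = inES-mono (pathES-⊆ Q′ edges′) (u , w)
                (matched-edge-on-path aug′ (△-isMatching aug M-matching) u w u∈Q′ matched-after)

    size-⊕-after : size ((M △ Q) ⊕ N) + pathLen Q ≤ size (M ⊕ N)
    size-⊕-after = begin
      size ((M △ Q) ⊕ N) + pathLen Q                           ≡⟨ cong (size ((M △ Q) ⊕ N) +_) (sym (size-path aug)) ⟩
      size ((M △ Q) ⊕ N) + size (pathES Q)                     ≡⟨ sym (size-+ ((M △ Q) ⊕ N) (pathES Q)) ⟩
      total (λ l x → ⟦ ((M △ Q) ⊕ N) l x ⟧ + ⟦ pathES Q l x ⟧)  ≤⟨ total-mono-≤ pointwise ⟩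
      total (λ l x → ⟦ (M ⊕ N) l x ⟧)                            ≡⟨ sym (size≡total (M ⊕ N)) ⟩
      size (M ⊕ N)                                             ∎
      where
      open ≤-Reasoning
      pointwise : ∀ l x → ⟦ ((M △ Q) ⊕ N) l x ⟧ + ⟦ pathES Q l x ⟧ ≤ ⟦ (M ⊕ N) l x ⟧
      pointwise l x with pathES Q l x in p
      ... | true = subst₂ (λ a c → ⟦ a ⟧ + 1 ≤ ⟦ c ⟧)
                     (sym (flipped (M l x) (N l x) (on-path⇒⊕ l x p))) (sym (on-path⇒⊕ l x p)) ≤-refl
      ... | false rewrite xor-identityʳ (M l x) = ≤-reflexive (+-identityʳ _)

    family-∷ : ∀ {Qs} → AugmentingFamily (M △ Q) N Qs → AugmentingFamily M N (Q ∷ Qs)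
    family-∷ family = record
      { augmenting = (aug , edges) ∷ All-map (λ p → pull-back (proj₁ p) (proj₂ p)) augmenting
      ; disjoint = All-map (λ p {v} → disjoint-after (proj₁ p) (proj₂ p) {v}) augmenting ∷ disjoint
      ; total-length = ≤-trans (+-monoʳ-≤ (pathLen Q) total-length)
                         (≤-trans (≤-reflexive (+-comm (pathLen Q) _)) size-⊕-after) }
      where open AugmentingFamily family

  augmenting-family : ∀ d {M N : EdgeSet n r} → IsMatching M → IsMatching N → size M + d ≤ size N →
                      ∃[ Qs ] (length Qs ≡ d × AugmentingFamily M N Qs)
  augmenting-family zero _ _ _ = [] , refl , record { augmenting = [] ; disjoint = [] ; total-length = z≤n }
  augmenting-family (suc d) {M} {N} M-matching N-matching M+d<N = extend (augmenting⊕-exists M-matching N-matching M<N)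
    where
    M<N : size M < size N
    M<N = ≤-trans (s≤s (m≤m+n (size M) d)) (≤-trans (≤-reflexive (sym (+-suc (size M) d))) M+d<N)
    extend : ∃[ Q ] Augmenting⊕ M N Q → ∃[ Qs ] (length Qs ≡ suc d × AugmentingFamily M N Qs)
    extend (Q , aug⊕) =
      let aug : Augmenting M Q
          aug = augmenting⊕⇒augmenting aug⊕
          M△Q+d≤N : size (M △ Q) + d ≤ size N
          M△Q+d≤N = ≤-trans (≤-reflexive (trans (cong (_+ d) (size-△ aug)) (+-assoc (size M) 1 d))) M+d<N
          Qs , length≡d , family = augmenting-family d (△-isMatching aug M-matching) N-matching M△Q+d≤N
      in Q ∷ Qs , cong suc length≡d , family-∷ M-matching aug (Augmenting⊕.edges aug⊕) family

module _ {n r : ℕ} (adj : Fin n → Fin r → Bool) where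

  InGraph : ℕ → EdgeSet n r → Set
  InGraph t X = ∀ l x → X l x ≡ true → (toℕ l < t) × (adj l x ≡ true)

  linked⇒pairs : ∀ {R : V n r → V n r → Set} (xs : List (V n r)) →
                 Linked R xs → All (λ e → R (proj₁ e) (proj₂ e)) (pairs xs)
  linked⇒pairs [] _ = []
  linked⇒pairs (x ∷ []) _ = []
  linked⇒pairs (x ∷ y ∷ xs) (p ∷ ps) = p ∷ linked⇒pairs (y ∷ xs) ps

  pairs⇒linked : ∀ {R : V n r → V n r → Set} (xs : List (V n r)) →
                 All (λ e → R (proj₁ e) (proj₂ e)) (pairs xs) → Linked R xs
  pairs⇒linked [] _ = []
  pairs⇒linked (x ∷ []) _ = [-]
  pairs⇒linked (x ∷ y ∷ xs) (p ∷ ps) = p ∷ pairs⇒linked (y ∷ xs) ps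

  augPath⇒augmenting : ∀ {t M Q} → AugPath adj t M Q → Augmenting M Q
  augPath⇒augmenting {M = M} {Q} aug = record
    { start = start ; end = end ; middle = middle ; shape = shape ; unique = distinct ; alternating = alt
    ; start-free = startFree ∘ covers⇒covered M start
    ; end-free = endFree ∘ covers⇒covered M end
    ; crossing = All-map (λ {e} → adj⇒crossing (proj₁ e) (proj₂ e)) (linked⇒pairs Q isPath) }
    where
    open AugPath aug
    adj⇒crossing : ∀ {t} v w → Adj adj t v w → Crossing (v , w)
    adj⇒crossing (inj₁ _) (inj₂ _) _ = refl
    adj⇒crossing (inj₂ _) (inj₁ _) _ = refl

  augmenting⇒augPath : ∀ {t M Q} → Augmenting M Q → Linked (Adj adj t) Q → AugPath adj t M Q
  augmenting⇒augPath {M = M} aug linked = record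
    { start = start ; end = end ; middle = middle ; shape = shape ; distinct = unique ; isPath = linked
    ; alt = alternating
    ; startFree = start-free ∘ covered⇒covers M start
    ; endFree = end-free ∘ covered⇒covers M end }
    where open Augmenting aug

  edges⇒linked : ∀ {t Z} Q → InGraph t Z → Edges Z Q → Linked (Adj adj t) Q
  edges⇒linked Q in-graph edges = pairs⇒linked Q (All-map (λ {e} → adjacent e) edges)
    where
    adjacent : ∀ e → inES _ e ≡ true → Adj adj _ (proj₁ e) (proj₂ e)
    adjacent (inj₁ l , inj₂ x) = in-graph l x
    adjacent (inj₂ x , inj₁ l) = in-graph l x

  InGraph-suc : ∀ {t X} → InGraph t X → InGraph (suc t) X
  InGraph-suc in-graph l x p = m<n⇒m<1+n (proj₁ (in-graph l x p)) , proj₂ (in-graph l x p)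

  InGraph-⊕ : ∀ {t A B} → InGraph t A → InGraph t B → InGraph t (A ⊕ B)
  InGraph-⊕ {A = A} {B} in-A in-B l x p with A l x in eq
  ... | true = in-A l x eq
  ... | false = in-B l x p

  InGraph-△ : ∀ {t M} (P : List (V n r)) → InGraph t M → Linked (Adj adj t) P → InGraph t (M △ P)
  InGraph-△ {M = M} P in-M linked = InGraph-⊕ {A = M} {B = pathES P} in-M in-P
    where
    in-P : InGraph _ (pathES P)
    in-P l x p with any≡true⇒∈ (isEdge l x) (pairs P) p
    ... | e , e∈ , edge with isEdge-shape l x e edge | lookup (linked⇒pairs P linked) e∈
    ...   | inj₁ refl | a = a
    ...   | inj₂ refl | a = a

  linked-avoiding : ∀ {t} (u : Fin n) → toℕ u ≡ t → (xs : List (V n r)) →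
                    Linked (Adj adj (suc t)) xs → inj₁ u ∉ xs → Linked (Adj adj t) xs
  linked-avoiding u refl [] _ _ = []
  linked-avoiding u refl (x ∷ []) _ _ = [-]
  linked-avoiding u refl (x ∷ y ∷ xs) (p ∷ ps) u∉ =
    earlier x y p (u∉ ∘ here ∘ sym) (u∉ ∘ there ∘ here ∘ sym) ∷ linked-avoiding u refl (y ∷ xs) ps (u∉ ∘ there)
    where
    before : ∀ l → toℕ l < suc (toℕ u) → ¬ inj₁ l ≡ inj₁ {B = Fin r} u → toℕ l < toℕ u
    before l p l≢u = ≤∧≢⇒< (≤-pred p) (l≢u ∘ cong inj₁ ∘ toℕ-injective)
    earlier : ∀ a b → Adj adj (suc (toℕ u)) a b → ¬ a ≡ inj₁ u → ¬ b ≡ inj₁ u → Adj adj (toℕ u) a b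
    earlier (inj₁ l) (inj₂ x) (p , e) a≢u _ = before l p a≢u , e
    earlier (inj₂ x) (inj₁ l) (p , e) _ b≢u = before l p b≢u , e

-- The invariant maintained by the algorithm

module _ {n r : ℕ} (adj : Fin n → Fin r → Bool) (k : ℕ) (0<k : 0 < k) where

  record Invariant (t : ℕ) (M : EdgeSet n r) : Set where
    field
      matching : IsMatching M
      in-graph : InGraph adj t M
      long     : ∀ Q → AugPath adj t M Q → k ≤ pathLen Q

  module _ (l : Fin n) {M : EdgeSet n r} (inv : Invariant (toℕ l) M) where
    open Invariant inv

    avoiding-long : ∀ {Q} → AugPath adj (suc (toℕ l)) M Q → inj₁ l ∉ Q → k ≤ pathLen Q
    avoiding-long {Q} aug l∉ = long Q (augmenting⇒augPath adj (augPath⇒augmenting adj aug)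
                                   (linked-avoiding adj l refl Q (AugPath.isPath aug) l∉))

    idle-preserves : (∀ Q → AugPath adj (suc (toℕ l)) M Q → inj₁ l ∈ Q → k ∸ 1 < pathLen Q) →
                     Invariant (suc (toℕ l)) M
    idle-preserves through-l = record { matching = matching ; in-graph = InGraph-suc adj in-graph ; long = long′ }
      where
      long′ : ∀ Q → AugPath adj (suc (toℕ l)) M Q → k ≤ pathLen Q
      long′ Q aug with inj₁ l ∈? Q
      ... | yes l∈ = ∸1<⇒≤ 0<k (through-l Q aug l∈)
      ... | no l∉ = avoiding-long aug l∉

    module _ {P : List (V n r)} (P-path : AugPath adj (suc (toℕ l)) M P)
             (shortest : ∀ Q → AugPath adj (suc (toℕ l)) M Q → inj₁ l ∈ Q → pathLen P ≤ pathLen Q)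
             (short : pathLen P ≤ k ∸ 1) where

      private
        P-aug : Augmenting M P
        P-aug = augPath⇒augmenting adj P-path

        in-graph′ : InGraph adj (suc (toℕ l)) (M △ P)
        in-graph′ = InGraph-△ adj P (InGraph-suc adj in-graph) (AugPath.isPath P-path)

      length-bound : ∀ {Z} Q → InGraph adj (suc (toℕ l)) Z → Augmenting M Q → Edges Z Q →
                     (inj₁ l ∈ Q → pathLen P ≤ pathLen Q) × (inj₁ l ∉ Q → k ≤ pathLen Q)
      length-bound Q in-Z aug edges = shortest Q Q-path , avoiding-long Q-path
        where
        Q-path : AugPath adj (suc (toℕ l)) M Q
        Q-path = augmenting⇒augPath adj aug (edges⇒linked adj Q in-Z edges)

      -- at most one of two disjoint paths passes through l
      disjoint-length-bound : ∀ {Q₁ Q₂ : List (V n r)} {a₁ a₂} → Disjoint Q₁ Q₂ →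
        (inj₁ l ∈ Q₁ → pathLen P ≤ a₁) × (inj₁ l ∉ Q₁ → k ≤ a₁) →
        (inj₁ l ∈ Q₂ → pathLen P ≤ a₂) × (inj₁ l ∉ Q₂ → k ≤ a₂) → pathLen P + k ≤ a₁ + a₂
      disjoint-length-bound {Q₁} {Q₂} disjoint (in₁ , out₁) (in₂ , out₂) with inj₁ l ∈? Q₁ | inj₁ l ∈? Q₂
      ... | yes l∈₁ | yes l∈₂ = ⊥-elim (disjoint (l∈₁ , l∈₂))
      ... | yes l∈₁ | no l∉₂ = +-mono-≤ (in₁ l∈₁) (out₂ l∉₂)
      ... | no l∉₁ | yes l∈₂ = ≤-trans (≤-reflexive (+-comm (pathLen P) k)) (+-mono-≤ (out₁ l∉₁) (in₂ l∈₂))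
      ... | no l∉₁ | no l∉₂ = +-mono-≤ (≤-trans short (≤-trans (m∸n≤m k 1) (out₁ l∉₁))) (out₂ l∉₂)

      augment-long : ∀ P′ → AugPath adj (suc (toℕ l)) (M △ P) P′ → k ≤ pathLen P′
      augment-long P′ P′-path = from-family (augmenting-family 2 matching N-matching M+2≤N)
        where
        P′-aug : Augmenting (M △ P) P′
        P′-aug = augPath⇒augmenting adj P′-path
        N : EdgeSet n r
        N = (M △ P) △ P′
        N-matching : IsMatching N
        N-matching = △-isMatching P′-aug (△-isMatching P-aug matching)
        M+2≤N : size M + 2 ≤ size N
        M+2≤N = ≤-reflexive (sym (trans (size-△ P′-aug) (trans (cong (_+ 1) (size-△ P-aug)) (+-assoc (size M) 1 1))))
        in-M⊕N : InGraph adj (suc (toℕ l)) (M ⊕ N)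
        in-M⊕N = InGraph-⊕ adj (InGraph-suc adj in-graph) (InGraph-△ adj P′ in-graph′ (AugPath.isPath P′-path))

        from-family : ∃[ Qs ] (length Qs ≡ 2 × AugmentingFamily M N Qs) → k ≤ pathLen P′
        from-family (Q₁ ∷ Q₂ ∷ [] , refl , record { augmenting = (aug₁ , edges₁) ∷ (aug₂ , edges₂) ∷ []
                                                   ; disjoint = (disjoint₁₂ ∷ []) ∷ _
                                                   ; total-length = total-length }) =
          +-cancelˡ-≤ (pathLen P) k (pathLen P′) (begin
            pathLen P + k                        ≤⟨ disjoint-length-bound disjoint₁₂ (length-bound Q₁ in-M⊕N aug₁ edges₁)
                                                                                     (length-bound Q₂ in-M⊕N aug₂ edges₂) ⟩
            pathLen Q₁ + pathLen Q₂              ≡⟨ cong (pathLen Q₁ +_) (sym (+-identityʳ _)) ⟩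
            pathLen Q₁ + (pathLen Q₂ + 0)        ≤⟨ total-length ⟩
            size (M ⊕ N)                         ≤⟨ size-⊕-△△ M P P′ ⟩
            size (pathES P) + size (pathES P′)   ≡⟨ cong₂ _+_ (size-path P-aug) (size-path P′-aug) ⟩
            pathLen P + pathLen P′               ∎)
          where open ≤-Reasoning

      augment-preserves : Invariant (suc (toℕ l)) (M △ P)
      augment-preserves = record
        { matching = △-isMatching P-aug matching ; in-graph = in-graph′ ; long = augment-long }

-- Competitiveness

sum-map-≥ : ∀ {A : Set} (f : A → ℕ) b (xs : List A) → All (λ x → b ≤ f x) xs → length xs * b ≤ sum (map f xs)
sum-map-≥ f b [] [] = z≤n
sum-map-≥ f b (x ∷ xs) (b≤fx ∷ b≤fxs) = +-mono-≤ b≤fx (sum-map-≥ f b xs b≤fxs)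

odd-length-≥ : ∀ {k c L} → 2 ∣ k → 2 * c + 1 ≡ L → k ≤ L → k + 1 ≤ L
odd-length-≥ {k} {c} 2∣k refl k≤ = subst (_≤ 2 * c + 1) (+-comm 1 k) (≤∧≢⇒< k≤ λ { refl → 2∤odd 2∣k })
  where
  2∤odd : ¬ 2 ∣ 2 * c + 1
  2∤odd 2∣ with ∣1⇒≡1 (∣m+n∣m⇒∣n 2∣ (m∣m*n c))
  ... | ()

competitive-arith : ∀ k m d → d * (k + 1) ≤ m + (m + d) → k * (m + d) ≤ (k + 2) * m
competitive-arith k m d bound = begin
  k * (m + d)       ≡⟨ *-distribˡ-+ k m d ⟩
  k * m + k * d     ≤⟨ +-monoʳ-≤ (k * m) kd≤2m ⟩
  k * m + (m + m)   ≡⟨ ring k m ⟩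
  (k + 2) * m       ∎
  where
  open ≤-Reasoning
  ring : ∀ k m → k * m + (m + m) ≡ (k + 2) * m
  ring = solve-∀
  kd≤2m : k * d ≤ m + m
  kd≤2m = +-cancelʳ-≤ d (k * d) (m + m) (subst₂ _≤_ (ring₁ k d) (ring₂ m d) bound)
    where
    ring₁ : ∀ k d → d * (k + 1) ≡ k * d + d
    ring₁ = solve-∀
    ring₂ : ∀ m d → m + (m + d) ≡ m + m + d
    ring₂ = solve-∀

module _ {n r : ℕ} (adj : Fin n → Fin r → Bool) {k : ℕ} (0<k : 0 < k) {Ms : ℕ → EdgeSet n r}
         (run : IsRun adj k Ms) where

  step-preserves : ∀ l {M M′} → Invariant adj k 0<k (toℕ l) M → Step adj k l M M′ →
                   Invariant adj k 0<k (suc (toℕ l)) M′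
  step-preserves l inv (idle through-l) = idle-preserves adj k 0<k l inv through-l
  step-preserves l inv (augment P P-path _ shortest short) = augment-preserves adj k 0<k l inv P-path shortest short

  initial : Invariant adj k 0<k 0 (Ms 0)
  initial = record
    { matching = λ { (inj₁ l) (inj₂ x) _ p _ → ⊥-elim (empty p) ; (inj₂ x) (inj₁ l) _ p _ → ⊥-elim (empty p) }
    ; in-graph = λ l x p → ⊥-elim (empty p)
    ; long = λ Q aug → ⊥-elim (no-augPath aug) }
    where
    empty : ∀ {l x} → Ms 0 l x ≡ true → ⊥
    empty {l} {x} p = true≢false (trans (sym p) (proj₁ run l x))
    no-edge : ∀ {v w} → Adj adj 0 v w → ⊥
    no-edge {inj₁ _} {inj₂ _} (() , _)
    no-edge {inj₂ _} {inj₁ _} (() , _)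
    no-augPath : ∀ {Q} → AugPath adj 0 (Ms 0) Q → ⊥
    no-augPath record { middle = [] ; shape = refl ; isPath = p ∷ _ } = no-edge p
    no-augPath record { middle = _ ∷ _ ; shape = refl ; isPath = p ∷ _ } = no-edge p

  invariant : ∀ t → t ≤ n → Invariant adj k 0<k t (Ms t)
  invariant zero _ = initial
  invariant (suc t) t<n = subst (λ s → Invariant adj k 0<k (suc s) (Ms (suc s))) (toℕ-fromℕ< t<n)
    (step-preserves l (subst (λ s → Invariant adj k 0<k s (Ms s)) (sym (toℕ-fromℕ< t<n)) (invariant t (<⇒≤ t<n)))
                      (proj₂ run l))
    where
    l : Fin n
    l = fromℕ< t<n

  competitive : 2 ∣ k → ∀ Mopt → IsMaxMatching adj Mopt → k * size Mopt ≤ (k + 2) * size (Ms n)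
  competitive 2∣k Mopt ((in-graphₒ , rowₒ , colₒ) , maximum) =
    subst (λ o → k * o ≤ (k + 2) * m) m+d≡o
      (competitive-arith k m d (bound (augmenting-family d matching (row-col⇒matching rowₒ colₒ) (≤-reflexive m+d≡o))))
    where
    open Invariant (invariant n ≤-refl)
    m d : ℕ
    m = size (Ms n)
    d = size Mopt ∸ m
    m+d≡o : m + d ≡ size Mopt
    m+d≡o = m+[n∸m]≡n (maximum (Ms n) (in-graph , matching-row matching , matching-col matching))

    long-enough : ∀ {Q} → Augmenting (Ms n) Q × Edges (Ms n ⊕ Mopt) Q → k + 1 ≤ pathLen Q
    long-enough {Q} (aug , edges) =
      odd-length-≥ {c = count (Ms n) (pairs Q)} 2∣k (pathLen-odd aug)
        (long Q (augmenting⇒augPath adj aug (edges⇒linked adj Q (InGraph-⊕ adj in-graph in-graphₒ) edges)))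

    bound : ∃[ Qs ] (length Qs ≡ d × AugmentingFamily (Ms n) Mopt Qs) → d * (k + 1) ≤ m + (m + d)
    bound (Qs , length≡d , family) = begin
      d * (k + 1)                 ≡⟨ cong (_* (k + 1)) (sym length≡d) ⟩
      length Qs * (k + 1)         ≤⟨ sum-map-≥ pathLen (k + 1) Qs (All-map long-enough augmenting) ⟩
      sum (map pathLen Qs)        ≤⟨ total-length ⟩
      size (Ms n ⊕ Mopt)          ≤⟨ size-⊕-≤ (Ms n) Mopt ⟩
      m + size Mopt               ≡⟨ cong (m +_) (sym m+d≡o) ⟩
      m + (m + d)                 ∎
      where
      open ≤-Reasoning
      open AugmentingFamily family

theorem1 : (k : ℕ) → 0 < k → 2 ∣ k →
    ∃[ c ] ((n r : ℕ) (adj : Fin n → Fin r → Bool) (Ms : ℕ → EdgeSet n r) →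
      IsRun adj k Ms → (Mopt : EdgeSet n r) → IsMaxMatching adj Mopt →
      k * size Mopt ≤ (k + 2) * size (Ms n) + c)
theorem1 k 0<k 2∣k = 0 , λ n r adj Ms run Mopt maximum →
  ≤-trans (competitive adj 0<k {Ms} run 2∣k Mopt maximum) (m≤m+n _ 0)
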